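{- The implicative structure $(\mathfrak{P}(P),\subseteq,\to)$ induced by any (total) combinatory algebra $(P,\cdot,\mathtt{k},\mathtt{s})$ is intuitionistically consistent, i.e. $t^{\mathscr{A}}\neq\varnothing$ for every closed $\lambda$-term $t$.
   Context: A (total) combinatory algebra is a set $P$ with a total binary application $\cdot$ and elements $\mathtt{k},\mathtt{s}$ with $(\mathtt{k}\cdot x)\cdot y=x$ and $((\mathtt{s}\cdot x)\cdot y)\cdot z=(x\cdot z)\cdot(y\cdot z)$. Kleene's implication is $a\to b=\{z\in P:\forall x\in a,\ z\cdot x\in b\}$; with inclusion it makes $\mathscr{A}=\mathfrak{P}(P)$ an implicative structure (complete lattice, $\to$ anti-monotonic/monotonic and commuting with arbitrary meets, here intersections, in its second argument), with bottom $\bot=\varnothing$. In an implicative structure, application is $ab=\bigwedge\{c:a\preccurlyeq(b\to c)\}$, abstraction of $f$ is $\bigwedge_a(a\to f(a))$, and closed $\lambda$-terms are interpreted as $t^{\mathscr{A}}$ accordingly. An implicative structure is intuitionistically consistent when $t^{\mathscr{A}}\neq\bot$ for all closed $\lambda$-terms $t$. -}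

module Defs where

open import Level using (Level; _⊔_; Lift; lift) renaming (suc to lsuc)
open import Data.Nat using (ℕ) renaming (suc to nsuc)
open import Data.Fin using (Fin; zero; suc)
open import Data.Product using (Σ)
open import Relation.Binary.PropositionalEquality using (_≡_)

record CombinatoryAlgebra (ℓ : Level) : Set (lsuc ℓ) where
  infixl 5 _·_
  field
    Carrier : Set ℓ
    _·_     : Carrier → Carrier → Carrier
    k s     : Carrier
    k-law   : ∀ x y → k · x · y ≡ x
    s-law   : ∀ x y z → s · x · y · z ≡ (x · z) · (y · z)

-- Pure λ-terms in de Bruijn notation, scoped by the number of free
-- variables; closed λ-terms are the elements of Term 0.
data Term (n : ℕ) : Set where
  var : Fin n → Term n
  app : Term n → Term n → Term n
  lam : Term (nsuc n) → Term n

-- The implicative structure (𝔓(P), ⊆, →) induced by a combinatory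
-- algebra, with Kleene's implication, and the interpretation of
-- λ-terms in it (application ab = ⋀{c : a ⊆ (b → c)},
-- abstraction λf = ⋀_a (a → f a), meets = intersections).
-- Predicativity: subsets of P are predicates P → Set ℓ (𝔓 ℓ); meets
-- indexed by all such subsets land one universe up, so denotations of
-- terms are predicates P → Set (suc ℓ).
module KleeneStructure {ℓ : Level} (𝒫 : CombinatoryAlgebra ℓ) where
  open CombinatoryAlgebra 𝒫

  𝔓 : (a : Level) → Set (ℓ ⊔ lsuc a)
  𝔓 a = Carrier → Set a

  _⊆_ : ∀ {a b} → 𝔓 a → 𝔓 b → Set (ℓ ⊔ a ⊔ b)
  A ⊆ B = ∀ z → A z → B z

  _⇒_ : ∀ {a b} → 𝔓 a → 𝔓 b → 𝔓 (ℓ ⊔ a ⊔ b)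
  (A ⇒ B) z = ∀ x → A x → B (z · x)

  ∅ : 𝔓 ℓ
  ∅ _ = Lift ℓ Data.Empty.⊥
    where import Data.Empty

  _＠_ : 𝔓 (lsuc ℓ) → 𝔓 (lsuc ℓ) → 𝔓 (lsuc ℓ)
  (A ＠ B) z = ∀ (C : 𝔓 ℓ) → A ⊆ (B ⇒ C) → C z

  Λ : (𝔓 ℓ → 𝔓 (lsuc ℓ)) → 𝔓 (lsuc ℓ)
  Λ f z = ∀ (A : 𝔓 ℓ) → (A ⇒ f A) z

  Env : ℕ → Set (lsuc ℓ)
  Env n = Fin n → 𝔓 ℓ

  _▸_ : ∀ {n} → Env n → 𝔓 ℓ → Env (nsuc n)
  (ρ ▸ A) zero    = A
  (ρ ▸ A) (suc i) = ρ i

  ⟦_⟧ : ∀ {n} → Term n → Env n → 𝔓 (lsuc ℓ)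
  ⟦ var i ⟧   ρ z = Lift (lsuc ℓ) (ρ i z)
  ⟦ app t u ⟧ ρ   = ⟦ t ⟧ ρ ＠ ⟦ u ⟧ ρ
  ⟦ lam t ⟧   ρ   = Λ (λ A → ⟦ t ⟧ (ρ ▸ A))

  _^𝒜 : Term 0 → 𝔓 (lsuc ℓ)
  t ^𝒜 = ⟦ t ⟧ (λ ())

module Submission where

-- Idea: every closed λ-term t has a *realizer* in P, namely the
-- combinatory code of t obtained by bracket abstraction, and that code
-- lies in t^𝒜; in particular t^𝒜 ≠ ∅.

open import Defs
open import Level using (Level; lift)
open import Data.Product using (Σ; _,_)
open import Data.Nat using (ℕ) renaming (suc to nsuc)
open import Data.Fin using (Fin; zero; suc)
open import Data.Vec.Functional using (Vector; _∷_)
open import Relation.Binary.PropositionalEquality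
  using (_≡_; cong₂; subst; sym; module ≡-Reasoning)

module Realizability {ℓ : Level} (𝒫 : CombinatoryAlgebra ℓ) where
  open CombinatoryAlgebra 𝒫
  open KleeneStructure 𝒫

  data Code (n : ℕ) : Set where
    var   : Fin n → Code n
    K S   : Code n
    _∙_   : Code n → Code n → Code n

  infixl 5 _∙_

  eval : ∀ {n} → Code n → Vector Carrier n → Carrier
  eval (var i) v = v i
  eval K       v = k
  eval S       v = s
  eval (e ∙ f) v = eval e v · eval f v

  skk-identity : ∀ x → s · k · k · x ≡ x
  skk-identity x = begin
    s · k · k · x      ≡⟨ s-law k k x ⟩
    k · x · (k · x)    ≡⟨ k-law x (k · x) ⟩
    x                  ∎
    where open ≡-Reasoning

  abstr : ∀ {n} → Code (nsuc n) → Code n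
  abstr (var zero)    = S ∙ K ∙ K
  abstr (var (suc i)) = K ∙ var i
  abstr K             = K ∙ K
  abstr S             = K ∙ S
  abstr (e ∙ f)       = S ∙ abstr e ∙ abstr f

  abstr-β : ∀ {n} (e : Code (nsuc n)) (v : Vector Carrier n) (a : Carrier) →
            eval (abstr e) v · a ≡ eval e (a ∷ v)
  abstr-β (var zero)    v a = skk-identity a
  abstr-β (var (suc i)) v a = k-law (v i) a
  abstr-β K             v a = k-law k a
  abstr-β S             v a = k-law s a
  abstr-β (e ∙ f)       v a = begin
    s · eval (abstr e) v · eval (abstr f) v · a
      ≡⟨ s-law (eval (abstr e) v) (eval (abstr f) v) a ⟩
    eval (abstr e) v · a · (eval (abstr f) v · a)
      ≡⟨ cong₂ _·_ (abstr-β e v a) (abstr-β f v a) ⟩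
    eval e (a ∷ v) · eval f (a ∷ v)
      ∎
    where open ≡-Reasoning

  compile : ∀ {n} → Term n → Code n
  compile (var i)   = var i
  compile (app t u) = compile t ∙ compile u
  compile (lam t)   = abstr (compile t)

  _realizes_ : ∀ {n} → Vector Carrier n → Env n → Set ℓ
  v realizes ρ = ∀ i → ρ i (v i)

  extend-realizes : ∀ {n} {v : Vector Carrier n} {ρ : Env n} {a : Carrier}
                    {A : 𝔓 ℓ} → v realizes ρ → A a → (a ∷ v) realizes (ρ ▸ A)
  extend-realizes v⊨ρ a∈A zero    = a∈A
  extend-realizes v⊨ρ a∈A (suc i) = v⊨ρ i

  -- Abstraction: by the β-law, the code of λt
  -- applied to a ∈ A is the code of t with a for the bound variable.
  sound : ∀ {n} (t : Term n) (ρ : Env n) (v : Vector Carrier n) →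
          v realizes ρ → ⟦ t ⟧ ρ (eval (compile t) v)
  sound (var i)   ρ v v⊨ρ = lift (v⊨ρ i)
  sound (app t u) ρ v v⊨ρ C ⟦t⟧⊆⟦u⟧⇒C =
    ⟦t⟧⊆⟦u⟧⇒C (eval (compile t) v) (sound t ρ v v⊨ρ)
              (eval (compile u) v) (sound u ρ v v⊨ρ)
  sound (lam t)   ρ v v⊨ρ A a a∈A =
    subst (⟦ t ⟧ (ρ ▸ A)) (sym (abstr-β (compile t) v a))
          (sound t (ρ ▸ A) (a ∷ v) (extend-realizes v⊨ρ a∈A))

  closed-realizer : (t : Term 0) → (t ^𝒜) (eval (compile t) (λ ()))
  closed-realizer t = sound t (λ ()) (λ ()) (λ ())

proposition2p32 : {ℓ : Level} (𝒫 : CombinatoryAlgebra ℓ) (t : Term 0) →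
    Σ (CombinatoryAlgebra.Carrier 𝒫) (λ z → KleeneStructure._^𝒜 𝒫 t z)
proposition2p32 𝒫 t = eval (compile t) (λ ()) , closed-realizer t
  where open Realizability 𝒫
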